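{- Let $\gamma_0(x)=\sum_{n\ge0}\mathcal{C}_{n,0}x^n=\frac{1-\sqrt{1-4x}}{2x}$ and $\Gamma(x,y)=\sum_{n,m\ge0}\mathcal{C}_{n+m,m}x^ny^m$, as formal power series. Then \[\Gamma(x,y)=\frac{\gamma_0(x)}{1-y\,\gamma_0(x)^2}=\frac{x\left(1-\sqrt{1-4x}\right)}{2x(x+y)-y\left(1-\sqrt{1-4x}\right)},\] the last equality holding in the field of fractions of $\mathbb{Q}[[x,y]]$.
   Context: A path is a finite sequence of points of $\mathbb{Z}^2$ in which each step is $(1,0)$ or $(0,1)$. For integers $0\le m\le n$, $\mathcal{C}_{n,m}$ denotes the number of paths from $(0,-2m)$ to $(n-m,n-m)$ not crossing the line $y=x$, i.e. all of whose points $(p,q)$ satisfy $q\le p$. Here $\sqrt{1-4x}$ is the formal power series with constant term $1$ whose square is $1-4x$. -}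

module Defs where

open import Data.Bool using (Bool; true; false)
open import Data.Nat as ℕ using (ℕ; zero; suc; _∸_)
open import Data.Integer as ℤ using (ℤ; +_)
open import Data.Rational as ℚ using (ℚ; 0ℚ; 1ℚ)
open import Data.List using (List; []; _∷_; map; _++_; filter; length)
open import Data.List.Relation.Unary.All using (All; all?)
open import Data.Product using (_×_; _,_)
open import Relation.Binary.PropositionalEquality using (_≡_)
open import Relation.Nullary.Decidable using (Dec; _×-dec_)

-- Lattice paths.  A step is a Bool: true = (1,0), false = (0,1).
-- A path from (p,q) is determined by its start point and its list of steps.

points : ℤ → ℤ → List Bool → List (ℤ × ℤ)
points p q [] = (p , q) ∷ []
points p q (true  ∷ w) = (p , q) ∷ points (p ℤ.+ ℤ.1ℤ) q w
points p q (false ∷ w) = (p , q) ∷ points p (q ℤ.+ ℤ.1ℤ) w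

endX endY : ℤ → ℤ → List Bool → ℤ
endX p q [] = p
endX p q (true  ∷ w) = endX (p ℤ.+ ℤ.1ℤ) q w
endX p q (false ∷ w) = endX p (q ℤ.+ ℤ.1ℤ) w
endY p q [] = q
endY p q (true  ∷ w) = endY (p ℤ.+ ℤ.1ℤ) q w
endY p q (false ∷ w) = endY p (q ℤ.+ ℤ.1ℤ) w

words : ℕ → List (List Bool)
words zero = [] ∷ []
words (suc k) = map (true ∷_) (words k) ++ map (false ∷_) (words k)

Below : ℤ × ℤ → Set
Below (p , q) = q ℤ.≤ p

IsGoodPath : ℤ → ℤ → ℤ → ℤ → List Bool → Set
IsGoodPath p0 q0 p1 q1 w =
  All Below (points p0 q0 w) × (endX p0 q0 w ≡ p1 × endY p0 q0 w ≡ q1)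

isGoodPath? : ∀ p0 q0 p1 q1 w → Dec (IsGoodPath p0 q0 p1 q1 w)
isGoodPath? p0 q0 p1 q1 w =
  all? (λ { (p , q) → q ℤ.≤? p }) (points p0 q0 w)
  ×-dec ((endX p0 q0 w ℤ.≟ p1) ×-dec (endY p0 q0 w ℤ.≟ q1))

-- Number of paths from (p0,q0) to (p1,q1) not crossing y = x.
-- Every step raises p+q by 1, so any such path has exactly
-- |(p1+q1) - (p0+q0)| steps; we enumerate all step words of that length.
numPaths : ℤ → ℤ → ℤ → ℤ → ℕ
numPaths p0 q0 p1 q1 =
  length (filter (isGoodPath? p0 q0 p1 q1)
                 (words ℤ.∣ (p1 ℤ.+ q1) ℤ.- (p0 ℤ.+ q0) ∣))

-- 𝒞_{n,m}: paths from (0,-2m) to (n-m,n-m) not crossing y = x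
-- (only used with m ≤ n, so truncated subtraction is harmless)
𝒞 : ℕ → ℕ → ℕ
𝒞 n m = numPaths (+ 0) (ℤ.- (+ (2 ℕ.* m))) (+ (n ∸ m)) (+ (n ∸ m))

-- Formal power series in ℚ[[x,y]]: coefficient functions, f n m = [x^n y^m] f.

Series₂ : Set
Series₂ = ℕ → ℕ → ℚ

_≈_ : Series₂ → Series₂ → Set
f ≈ g = ∀ n m → f n m ≡ g n m
infix 4 _≈_

ℕtoℚ : ℕ → ℚ
ℕtoℚ k = + k ℚ./ 1

sumTo : ℕ → (ℕ → ℚ) → ℚ
sumTo zero f = f zero
sumTo (suc n) f = sumTo n f ℚ.+ f (suc n)

_+ₛ_ _-ₛ_ _*ₛ_ : Series₂ → Series₂ → Series₂
(f +ₛ g) n m = f n m ℚ.+ g n m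
(f -ₛ g) n m = f n m ℚ.- g n m
(f *ₛ g) n m = sumTo n (λ i → sumTo m (λ j → f i j ℚ.* g (n ∸ i) (m ∸ j)))
infixl 6 _+ₛ_ _-ₛ_
infixl 7 _*ₛ_

cst : ℚ → Series₂
cst c zero zero = c
cst c _ _ = 0ℚ

X Y : Series₂
X (suc zero) zero = 1ℚ
X _ _ = 0ℚ
Y zero (suc zero) = 1ℚ
Y _ _ = 0ℚ

ι : (ℕ → ℚ) → Series₂
ι f n zero = f n
ι f n (suc _) = 0ℚ

γ₀ : Series₂
γ₀ = ι (λ n → ℕtoℚ (𝒞 n 0))

Γ : Series₂
Γ n m = ℕtoℚ (𝒞 (n ℕ.+ m) m)

{-# OPTIONS --safe #-}
module Submission where

-- Let B_d ∈ ℚ[[x]] count the paths from a point at distance d from the diagonal back to it, by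
-- their number of right steps; 𝒞_{n+m,m} is the coefficient of x^n in B_{2m}. Splitting the
-- first step gives the ballot recurrence, which forces B_{d+1} = γ₀ B_d, so B_d = γ₀^{d+1},
-- γ₀ = 1 + x γ₀² and Γ = Σ_m y^m B_{2m} = γ₀ + y γ₀² Γ. The Catalan equation makes 1 - 2xγ₀
-- a square root of 1 - 4x, and square roots r, r' with r + r' regular are equal; here the
-- sum has constant term 2. Everything else is ring algebra in ℚ[[x,y]].

open import Algebra.Bundles using (CommutativeRing)
open import Algebra.Core using (Op₁; Op₂)
open import Algebra.Structures using (IsAbelianGroup; IsCommutativeRing)
import Algebra.Consequences.Setoid as Consequences
import Algebra.Construct.Pointwise as Pointwise
import Algebra.Properties.CommutativeSemigroup as CommutativeSemigroupProperties
import Algebra.Solver.Ring as RingSolver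
open import Algebra.Solver.Ring.AlmostCommutativeRing using (_-Raw-AlmostCommutative⟶_; fromCommutativeRing)
open import Data.Bool using (true; false)
open import Data.Integer as ℤ using (ℤ; +_; ∣_∣)
import Data.Integer.Properties as ℤ
open import Data.Integer.Solver using () renaming (module +-*-Solver to IntegerSolver)
open import Data.List as List using ([]; _∷_; _++_; filter; length)
open import Data.List.Properties using (filter-++; length-++; filter-accept; filter-reject; filter-none)
open import Data.List.Relation.Unary.All as All using (All; []; _∷_)
open import Data.Maybe as Maybe using ()
open import Data.Nat as ℕ using (ℕ; zero; suc; _∸_; z≤n; s≤s)
import Data.Nat.Coprimality as Coprime
import Data.Nat.Properties as ℕ
open import Data.Product using (_×_; _,_; proj₁; map₁)
open import Data.Rational as ℚ using (ℚ; 0ℚ; 1ℚ)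
import Data.Rational.Properties as ℚ
open import Data.Rational.Solver using () renaming (module +-*-Solver to RationalSolver)
open import Data.Sum using (inj₁; inj₂)
open import Function using (_∘_)
open import Level using (_⊔_)
open import Relation.Binary.Bundles using (Setoid)
open import Relation.Binary.Core using (Rel)
open import Relation.Binary.PropositionalEquality as ≡ using (_≡_)
import Relation.Binary.Reasoning.Setoid as SetoidReasoning
open import Relation.Nullary using (¬_; yes; no; contradiction)
open import Relation.Nullary.Decidable using (dec⇒maybe)
open import Relation.Unary using (Pred; Decidable)

-- Commutative rings

Regular : ∀ {c ℓ} (R : CommutativeRing c ℓ) → CommutativeRing.Carrier R → Set (c ⊔ ℓ)
Regular R r = ∀ a → a * r ≈ 0# → a ≈ 0#
  where open CommutativeRing R

module _ {c ℓ} (R : CommutativeRing c ℓ) where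
  open CommutativeRing R hiding (zero)

  withMultiplication : (_∙_ : Op₂ Carrier) → (∀ x y → x ∙ y ≈ x * y) → CommutativeRing c ℓ
  withMultiplication _∙_ ∙≈* = record
    { Carrier = Carrier ; _≈_ = _≈_ ; _+_ = _+_ ; _*_ = _∙_ ; -_ = -_ ; 0# = 0# ; 1# = 1#
    ; isCommutativeRing = record
      { isRing = record
        { +-isAbelianGroup = +-isAbelianGroup
        ; *-cong = λ {x} {x′} {y} {y′} x≈x′ y≈y′ → begin
            x ∙ y    ≈⟨ ∙≈* x y ⟩
            x * y    ≈⟨ *-cong x≈x′ y≈y′ ⟩
            x′ * y′  ≈⟨ ∙≈* x′ y′ ⟨
            x′ ∙ y′  ∎
        ; *-assoc = λ x y z → begin
            (x ∙ y) ∙ z  ≈⟨ ∙≈* (x ∙ y) z ⟩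
            (x ∙ y) * z  ≈⟨ *-congʳ (∙≈* x y) ⟩
            (x * y) * z  ≈⟨ *-assoc x y z ⟩
            x * (y * z)  ≈⟨ *-congˡ (∙≈* y z) ⟨
            x * (y ∙ z)  ≈⟨ ∙≈* x (y ∙ z) ⟨
            x ∙ (y ∙ z)  ∎
        ; *-identity = (λ x → trans (∙≈* 1# x) (*-identityˡ x))
                     , (λ x → trans (∙≈* x 1#) (*-identityʳ x))
        ; distrib = (λ x y z → begin
            x ∙ (y + z)      ≈⟨ ∙≈* x (y + z) ⟩
            x * (y + z)      ≈⟨ distribˡ x y z ⟩
            x * y + x * z    ≈⟨ +-cong (∙≈* x y) (∙≈* x z) ⟨
            x ∙ y + x ∙ z    ∎)
                  , (λ x y z → begin
            (y + z) ∙ x      ≈⟨ ∙≈* (y + z) x ⟩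
            (y + z) * x      ≈⟨ distribʳ x y z ⟩
            y * x + z * x    ≈⟨ +-cong (∙≈* y x) (∙≈* z x) ⟨
            y ∙ x + z ∙ x    ∎)
        }
      ; *-comm = λ x y → trans (∙≈* x y) (trans (*-comm x y) (sym (∙≈* y x)))
      }
    }
    where open SetoidReasoning setoid

module _ {c ℓ} (R : CommutativeRing c ℓ) where
  open CommutativeRing R
  open import Algebra.Properties.Ring ring using (-‿distribˡ-*)
  open import Algebra.Properties.AbelianGroup +-abelianGroup using (x∙y⁻¹≈ε⇒x≈y)
  open SetoidReasoning setoid

  square-injective : ∀ {u v} → Regular R (u + v) → u * u ≈ v * v → u ≈ v
  square-injective {u} {v} u+v-regular u²≈v² = x∙y⁻¹≈ε⇒x≈y u v (u+v-regular (u - v) (begin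
    (u - v) * (u + v)            ≈⟨ distribʳ (u + v) u (- v) ⟩
    u * (u + v) + - v * (u + v)  ≈⟨ +-cong u[u+v]≈v[u+v] (sym (-‿distribˡ-* v (u + v))) ⟩
    v * (u + v) - v * (u + v)    ≈⟨ -‿inverseʳ (v * (u + v)) ⟩
    0#                           ∎))
    where
    u[u+v]≈v[u+v] : u * (u + v) ≈ v * (u + v)
    u[u+v]≈v[u+v] = begin
      u * (u + v)    ≈⟨ distribˡ u u v ⟩
      u * u + u * v  ≈⟨ +-cong u²≈v² (*-comm u v) ⟩
      v * v + v * u  ≈⟨ distribˡ v v u ⟨
      v * (v + u)    ≈⟨ *-congˡ (+-comm v u) ⟩
      v * (u + v)    ∎

-- Formal power series over a commutative ring

module Sum {c ℓ} (R : CommutativeRing c ℓ) where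
  open CommutativeRing R hiding (zero)
  open SetoidReasoning setoid

  ∑≤ : ℕ → (ℕ → Carrier) → Carrier
  ∑≤ zero    f = f zero
  ∑≤ (suc n) f = ∑≤ n f + f (suc n)

  ∑≤-cong : ∀ n {f g} → (∀ i → i ℕ.≤ n → f i ≈ g i) → ∑≤ n f ≈ ∑≤ n g
  ∑≤-cong zero    f≈g = f≈g 0 z≤n
  ∑≤-cong (suc n) f≈g =
    +-cong (∑≤-cong n (λ i i≤n → f≈g i (ℕ.m≤n⇒m≤1+n i≤n))) (f≈g (suc n) ℕ.≤-refl)

  ∑≤-zero : ∀ n {f} → (∀ i → i ℕ.≤ n → f i ≈ 0#) → ∑≤ n f ≈ 0#
  ∑≤-zero zero    f≈0 = f≈0 0 z≤n
  ∑≤-zero (suc n) f≈0 = trans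
    (+-cong (∑≤-zero n (λ i i≤n → f≈0 i (ℕ.m≤n⇒m≤1+n i≤n))) (f≈0 (suc n) ℕ.≤-refl))
    (+-identityˡ 0#)

  ∑≤-distrib-+ : ∀ n f g → ∑≤ n (λ i → f i + g i) ≈ ∑≤ n f + ∑≤ n g
  ∑≤-distrib-+ zero    f g = refl
  ∑≤-distrib-+ (suc n) f g = begin
    ∑≤ n (λ i → f i + g i) + (f (suc n) + g (suc n))  ≈⟨ +-congʳ (∑≤-distrib-+ n f g) ⟩
    (∑≤ n f + ∑≤ n g) + (f (suc n) + g (suc n))       ≈⟨ interchange _ _ _ _ ⟩
    (∑≤ n f + f (suc n)) + (∑≤ n g + g (suc n))       ∎
    where open CommutativeSemigroupProperties +-commutativeSemigroup using (interchange)

  *-distribˡ-∑≤ : ∀ n a f → a * ∑≤ n f ≈ ∑≤ n (λ i → a * f i)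
  *-distribˡ-∑≤ zero    a f = refl
  *-distribˡ-∑≤ (suc n) a f = trans (distribˡ a (∑≤ n f) (f (suc n))) (+-congʳ (*-distribˡ-∑≤ n a f))

  ∑≤-suc : ∀ n f → ∑≤ (suc n) f ≈ f 0 + ∑≤ n (f ∘ suc)
  ∑≤-suc zero    f = refl
  ∑≤-suc (suc n) f = trans (+-congʳ (∑≤-suc n f)) (+-assoc (f 0) (∑≤ n (f ∘ suc)) (f (suc (suc n))))

  ∑≤-reverse : ∀ n f → ∑≤ n f ≈ ∑≤ n (λ i → f (n ∸ i))
  ∑≤-reverse zero    f = refl
  ∑≤-reverse (suc n) f = begin
    ∑≤ n f + f (suc n)                        ≈⟨ +-congʳ (∑≤-reverse n f) ⟩
    ∑≤ n (λ i → f (n ∸ i)) + f (suc n)        ≈⟨ +-comm _ _ ⟩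
    f (suc n) + ∑≤ n (λ i → f (n ∸ i))        ≈⟨ ∑≤-suc n (λ i → f (suc n ∸ i)) ⟨
    ∑≤ (suc n) (λ i → f (suc n ∸ i))          ∎

module PowerSeries {c ℓ} (R : CommutativeRing c ℓ) where
  open CommutativeRing R hiding (zero; isCommutativeRing)
  open Sum R public
  open SetoidReasoning setoid

  PowerSeries : Set c
  PowerSeries = ℕ → Carrier

  infix  4 _≋_
  infixl 6 _⊕_
  infixl 7 _⊛_
  infix  8 ⊝_

  _≋_ : Rel PowerSeries ℓ
  f ≋ g = ∀ n → f n ≈ g n

  _⊕_ : Op₂ PowerSeries
  (f ⊕ g) n = f n + g n

  ⊝_ : Op₁ PowerSeries
  (⊝ f) n = - f n

  0ₚ : PowerSeries
  0ₚ _ = 0#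

  constant : Carrier → PowerSeries
  constant a zero    = a
  constant a (suc _) = 0#

  1ₚ : PowerSeries
  1ₚ = constant 1#

  𝕏 : PowerSeries
  𝕏 zero    = 0#
  𝕏 (suc n) = 1ₚ n

  _⊛_ : Op₂ PowerSeries
  (f ⊛ g) n = ∑≤ n (λ i → f i * g (n ∸ i))

  ⊛-cong-≤ : ∀ n {f f′ g g′} →
             (∀ i → i ℕ.≤ n → f i ≈ f′ i) → (∀ i → i ℕ.≤ n → g i ≈ g′ i) → (f ⊛ g) n ≈ (f′ ⊛ g′) n
  ⊛-cong-≤ n f≈f′ g≈g′ =
    ∑≤-cong n (λ i i≤n → *-cong (f≈f′ i i≤n) (g≈g′ (n ∸ i) (ℕ.m∸n≤m n i)))

  ⊛-congˡ-≤ : ∀ n {f f′} g → (∀ i → i ℕ.≤ n → f i ≈ f′ i) → (f ⊛ g) n ≈ (f′ ⊛ g) n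
  ⊛-congˡ-≤ n g f≈f′ = ⊛-cong-≤ n {g = g} {g′ = g} f≈f′ (λ _ _ → refl)

  ⊛-congʳ-≤ : ∀ n f {g g′} → (∀ i → i ℕ.≤ n → g i ≈ g′ i) → (f ⊛ g) n ≈ (f ⊛ g′) n
  ⊛-congʳ-≤ n f g≈g′ = ⊛-cong-≤ n {f = f} {f′ = f} (λ _ _ → refl) g≈g′

  ⊛-cong : ∀ {f f′ g g′} → f ≋ f′ → g ≋ g′ → f ⊛ g ≋ f′ ⊛ g′
  ⊛-cong f≈f′ g≈g′ n = ⊛-cong-≤ n (λ i _ → f≈f′ i) (λ i _ → g≈g′ i)

  ⊛-suc : ∀ n f g → (f ⊛ g) (suc n) ≈ f 0 * g (suc n) + ((f ∘ suc) ⊛ g) n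
  ⊛-suc n f g = ∑≤-suc n (λ i → f i * g (suc n ∸ i))

  ⊛-comm : ∀ f g → f ⊛ g ≋ g ⊛ f
  ⊛-comm f g n = trans (∑≤-reverse n _) (∑≤-cong n λ i i≤n →
    trans (*-comm _ _) (*-congʳ (reflexive (≡.cong g (ℕ.m∸[m∸n]≡n i≤n)))))

  ⊛-distribʳ : ∀ h f g → (f ⊕ g) ⊛ h ≋ f ⊛ h ⊕ g ⊛ h
  ⊛-distribʳ h f g n =
    trans (∑≤-cong n (λ i _ → distribʳ (h (n ∸ i)) (f i) (g i))) (∑≤-distrib-+ n _ _)

  ⊛-scaleˡ : ∀ n a f g → ((λ i → a * f i) ⊛ g) n ≈ a * (f ⊛ g) n
  ⊛-scaleˡ n a f g = trans (∑≤-cong n (λ i _ → *-assoc a (f i) (g (n ∸ i)))) (sym (*-distribˡ-∑≤ n a _))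

  ⊛-assoc : ∀ f g h → (f ⊛ g) ⊛ h ≋ f ⊛ (g ⊛ h)
  ⊛-assoc f g h zero    = *-assoc (f 0) (g 0) (h 0)
  ⊛-assoc f g h (suc n) = begin
    ((f ⊛ g) ⊛ h) (suc n)
      ≈⟨ ⊛-suc n (f ⊛ g) h ⟩
    f 0 * g 0 * h (suc n) + (((f ⊛ g) ∘ suc) ⊛ h) n
      ≈⟨ +-congˡ (⊛-congˡ-≤ n h (λ i _ → ⊛-suc i f g)) ⟩
    f 0 * g 0 * h (suc n) + (((λ i → f 0 * g (suc i)) ⊕ (f ∘ suc) ⊛ g) ⊛ h) n
      ≈⟨ +-congˡ (⊛-distribʳ h _ _ n) ⟩
    f 0 * g 0 * h (suc n) + (((λ i → f 0 * g (suc i)) ⊛ h) n + (((f ∘ suc) ⊛ g) ⊛ h) n)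
      ≈⟨ +-congˡ (+-cong (⊛-scaleˡ n (f 0) (g ∘ suc) h) (⊛-assoc (f ∘ suc) g h n)) ⟩
    f 0 * g 0 * h (suc n) + (f 0 * ((g ∘ suc) ⊛ h) n + ((f ∘ suc) ⊛ (g ⊛ h)) n)
      ≈⟨ +-assoc _ _ _ ⟨
    f 0 * g 0 * h (suc n) + f 0 * ((g ∘ suc) ⊛ h) n + ((f ∘ suc) ⊛ (g ⊛ h)) n
      ≈⟨ +-congʳ (+-congʳ (*-assoc (f 0) (g 0) (h (suc n)))) ⟩
    f 0 * (g 0 * h (suc n)) + f 0 * ((g ∘ suc) ⊛ h) n + ((f ∘ suc) ⊛ (g ⊛ h)) n
      ≈⟨ +-congʳ (distribˡ (f 0) _ _) ⟨
    f 0 * (g 0 * h (suc n) + ((g ∘ suc) ⊛ h) n) + ((f ∘ suc) ⊛ (g ⊛ h)) n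
      ≈⟨ +-congʳ (*-congˡ (⊛-suc n g h)) ⟨
    f 0 * (g ⊛ h) (suc n) + ((f ∘ suc) ⊛ (g ⊛ h)) n
      ≈⟨ ⊛-suc n f (g ⊛ h) ⟨
    (f ⊛ (g ⊛ h)) (suc n) ∎

  constant-⊛ : ∀ a f → constant a ⊛ f ≋ (λ n → a * f n)
  constant-⊛ a f zero    = refl
  constant-⊛ a f (suc n) = begin
    (constant a ⊛ f) (suc n)                   ≈⟨ ⊛-suc n (constant a) f ⟩
    a * f (suc n) + (0ₚ ⊛ f) n                 ≈⟨ +-congˡ (∑≤-zero n (λ i _ → zeroˡ (f (n ∸ i)))) ⟩
    a * f (suc n) + 0#                         ≈⟨ +-identityʳ _ ⟩
    a * f (suc n)                              ∎

  𝕏-⊛-zero : ∀ f → (𝕏 ⊛ f) 0 ≈ 0#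
  𝕏-⊛-zero f = zeroˡ (f 0)

  𝕏-⊛-suc : ∀ f n → (𝕏 ⊛ f) (suc n) ≈ f n
  𝕏-⊛-suc f n = begin
    (𝕏 ⊛ f) (suc n)            ≈⟨ ⊛-suc n 𝕏 f ⟩
    0# * f (suc n) + (1ₚ ⊛ f) n  ≈⟨ +-cong (zeroˡ _) (constant-⊛ 1# f n) ⟩
    0# + 1# * f n                ≈⟨ +-identityˡ _ ⟩
    1# * f n                     ≈⟨ *-identityˡ _ ⟩
    f n                          ∎

  ≋-setoid : Setoid c ℓ
  ≋-setoid = record { isEquivalence = Pointwise.isEquivalence ℕ isEquivalence }

  ⊕-isAbelianGroup : IsAbelianGroup _≋_ _⊕_ 0ₚ ⊝_
  ⊕-isAbelianGroup = Pointwise.isAbelianGroup ℕ +-isAbelianGroup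

  isCommutativeRing : IsCommutativeRing _≋_ _⊕_ _⊛_ ⊝_ 0ₚ 1ₚ
  isCommutativeRing = record
    { isRing = record
      { +-isAbelianGroup = ⊕-isAbelianGroup
      ; *-cong           = ⊛-cong
      ; *-assoc          = ⊛-assoc
      ; *-identity       = comm∧idˡ⇒id ⊛-comm λ f n → trans (constant-⊛ 1# f n) (*-identityˡ (f n))
      ; distrib          = comm∧distrʳ⇒distr (IsAbelianGroup.∙-cong ⊕-isAbelianGroup) ⊛-comm ⊛-distribʳ
      }
    ; *-comm = ⊛-comm
    }
    where open Consequences ≋-setoid

  commutativeRing : CommutativeRing c ℓ
  commutativeRing = record { isCommutativeRing = isCommutativeRing }

  open Sum commutativeRing public using () renaming (∑≤ to ∑≤ₚ)

  ∑≤ₚ-apply : ∀ n F m → ∑≤ₚ n F m ≈ ∑≤ n (λ i → F i m)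
  ∑≤ₚ-apply zero    F m = refl
  ∑≤ₚ-apply (suc n) F m = +-congʳ (∑≤ₚ-apply n F m)

  regular-constantTerm⇒regular : ∀ {f} → Regular R (f 0) → Regular commutativeRing f
  regular-constantTerm⇒regular {f} f₀-regular g g⊛f≈0 n = vanishes n n ℕ.≤-refl
    where
    vanishes : ∀ n i → i ℕ.≤ n → g i ≈ 0#
    vanishes zero    .zero z≤n = f₀-regular (g 0) (g⊛f≈0 0)
    vanishes (suc n) i i≤1+n with ℕ.m≤n⇒m<n∨m≡n i≤1+n
    ... | inj₁ (s≤s i≤n) = vanishes n i i≤n
    ... | inj₂ ≡.refl    = f₀-regular (g (suc n)) (begin
      g (suc n) * f 0
        ≈⟨ *-congˡ (reflexive (≡.cong f (ℕ.n∸n≡0 n))) ⟨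
      g (suc n) * f (suc n ∸ suc n)
        ≈⟨ +-identityˡ _ ⟨
      0# + g (suc n) * f (suc n ∸ suc n)
        ≈⟨ +-congʳ (∑≤-zero n λ i i≤n → trans (*-congʳ (vanishes n i i≤n)) (zeroˡ _)) ⟨
      (g ⊛ f) (suc n)
        ≈⟨ g⊛f≈0 (suc n) ⟩
      0# ∎)

open import Defs

-- Lattice paths and ballot numbers

module _ {a p} {A B : Set a} {P : Pred A p} {Q : Pred B p} (P? : Decidable P) (Q? : Decidable Q) where

  length-filter-map : ∀ (f : B → A) → (∀ {x} → P (f x) → Q x) → (∀ {x} → Q x → P (f x)) →
                      ∀ xs → length (filter P? (List.map f xs)) ≡ length (filter Q? xs)
  length-filter-map f to from []       = ≡.refl
  length-filter-map f to from (x ∷ xs) with P? (f x) | Q? x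
  ... | yes _   | yes _  = ≡.cong suc (length-filter-map f to from xs)
  ... | no _    | no _   = length-filter-map f to from xs
  ... | yes Pfx | no ¬Qx = contradiction (to Pfx) ¬Qx
  ... | no ¬Pfx | yes Qx = contradiction (from Qx) ¬Pfx

+-double-injective : ∀ i j → i ℤ.+ i ≡ j ℤ.+ j → i ≡ j
+-double-injective i j i+i≡j+j = ℤ.*-cancelˡ-≡ (+ 2) i j (begin
  + 2 ℤ.* i   ≡⟨ double i ⟩
  i ℤ.+ i     ≡⟨ i+i≡j+j ⟩
  j ℤ.+ j     ≡⟨ double j ⟨
  + 2 ℤ.* j   ∎)
  where
  open ≡.≡-Reasoning
  double : ∀ i → + 2 ℤ.* i ≡ i ℤ.+ i
  double i =
    ≡.trans (ℤ.*-distribʳ-+ i ℤ.1ℤ ℤ.1ℤ) (≡.cong₂ ℤ._+_ (ℤ.*-identityˡ i) (ℤ.*-identityˡ i))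

-- ballot k d counts the paths of k steps from a point d steps right of the diagonal to the
-- diagonal, never crossing it: a right step moves one step away from it, an up step one closer.
ballot : ℕ → ℕ → ℕ
ballot zero    zero    = 1
ballot zero    (suc d) = 0
ballot (suc k) zero    = ballot k 1
ballot (suc k) (suc d) = ballot k (suc (suc d)) ℕ.+ ballot k d

ballot-below : ∀ {k d} → k ℕ.< d → ballot k d ≡ 0
ballot-below {zero}  {suc d} _         = ≡.refl
ballot-below {suc k} {suc d} (s≤s k<d) =
  ≡.cong₂ ℕ._+_ (ballot-below (ℕ.m<n⇒m<1+n (ℕ.m<n⇒m<1+n k<d))) (ballot-below k<d)

ballot-diagonal : ∀ d → ballot d d ≡ 1
ballot-diagonal zero    = ≡.refl
ballot-diagonal (suc d) = ≡.cong₂ ℕ._+_ (ballot-below {d} (ℕ.m<n⇒m<1+n ℕ.≤-refl)) (ballot-diagonal d)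

goodPaths : ℕ → ℤ → ℤ → ℤ → ℕ
goodPaths k p q t = length (filter (isGoodPath? p q t t) (words k))

goodPaths-suc : ∀ k {p q} t → q ℤ.≤ p →
                goodPaths (suc k) p q t ≡ goodPaths k (p ℤ.+ ℤ.1ℤ) q t ℕ.+ goodPaths k p (q ℤ.+ ℤ.1ℤ) t
goodPaths-suc k {p} {q} t q≤p = begin
  length (filter good? (rights ++ ups))
    ≡⟨ ≡.cong length (filter-++ good? rights ups) ⟩
  length (filter good? rights ++ filter good? ups)
    ≡⟨ length-++ (filter good? rights) ⟩
  length (filter good? rights) ℕ.+ length (filter good? ups)
    ≡⟨ ≡.cong₂ ℕ._+_ (length-filter-map good? (isGoodPath? _ q t t) (true ∷_) (map₁ All.tail) (map₁ (q≤p ∷_)) (words k))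
                     (length-filter-map good? (isGoodPath? p _ t t) (false ∷_) (map₁ All.tail) (map₁ (q≤p ∷_)) (words k)) ⟩
  goodPaths k (p ℤ.+ ℤ.1ℤ) q t ℕ.+ goodPaths k p (q ℤ.+ ℤ.1ℤ) t ∎
  where
  open ≡.≡-Reasoning
  good? = isGoodPath? p q t t
  rights = List.map (true ∷_) (words k)
  ups    = List.map (false ∷_) (words k)

goodPaths-blocked : ∀ k {p q} t → ¬ q ℤ.≤ p → goodPaths k p q t ≡ 0
goodPaths-blocked k {p} {q} t q≰p =
  ≡.cong length (filter-none (isGoodPath? p q t t)
    (All.universal (λ w → q≰p ∘ starts-below w ∘ proj₁) (words k)))
  where
  starts-below : ∀ w → All Below (points p q w) → q ℤ.≤ p
  starts-below []          (q≤p ∷ _) = q≤p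
  starts-below (true ∷ _)  (q≤p ∷ _) = q≤p
  starts-below (false ∷ _) (q≤p ∷ _) = q≤p

private
  start-below : ∀ {p} q d → p ≡ q ℤ.+ + d → q ℤ.≤ p
  start-below q d p≡q+d = ≡.subst (q ℤ.≤_) (≡.sym p≡q+d) (ℤ.i≤i+j q (+ d))

  right-start : ∀ {p} q d → p ≡ q ℤ.+ + d → p ℤ.+ ℤ.1ℤ ≡ q ℤ.+ + suc d
  right-start q d p≡q+d = ≡.trans (≡.cong (ℤ._+ ℤ.1ℤ) p≡q+d)
    (solve 2 (λ q d → q :+ d :+ con ℤ.1ℤ := q :+ (con ℤ.1ℤ :+ d)) ≡.refl q (+ d))
    where open IntegerSolver using (solve; _:+_; _:=_; con)

  up-start : ∀ {p} q d → p ≡ q ℤ.+ + suc d → p ≡ q ℤ.+ ℤ.1ℤ ℤ.+ + d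
  up-start q d p≡q+1+d = ≡.trans p≡q+1+d
    (solve 2 (λ q d → q :+ (con ℤ.1ℤ :+ d) := q :+ con ℤ.1ℤ :+ d) ≡.refl q (+ d))
    where open IntegerSolver using (solve; _:+_; _:=_; con)

  right-sum : ∀ p q k {t} → p ℤ.+ q ℤ.+ + suc k ≡ t → p ℤ.+ ℤ.1ℤ ℤ.+ q ℤ.+ + k ≡ t
  right-sum p q k = ≡.trans
    (solve 3 (λ p q k → p :+ con ℤ.1ℤ :+ q :+ k := p :+ q :+ (con ℤ.1ℤ :+ k)) ≡.refl p q (+ k))
    where open IntegerSolver using (solve; _:+_; _:=_; con)

  up-sum : ∀ p q k {t} → p ℤ.+ q ℤ.+ + suc k ≡ t → p ℤ.+ (q ℤ.+ ℤ.1ℤ) ℤ.+ + k ≡ t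
  up-sum p q k = ≡.trans
    (solve 3 (λ p q k → p :+ (q :+ con ℤ.1ℤ) :+ k := p :+ q :+ (con ℤ.1ℤ :+ k)) ≡.refl p q (+ k))
    where open IntegerSolver using (solve; _:+_; _:=_; con)

-- The first hypothesis puts the start at distance d from the diagonal, the second makes (t, t)
-- reachable in exactly k steps.
goodPaths≡ballot : ∀ k d p q t → p ≡ q ℤ.+ + d → p ℤ.+ q ℤ.+ + k ≡ t ℤ.+ t →
                   goodPaths k p q t ≡ ballot k d
goodPaths≡ballot zero zero p q t p≡q+0 p+q+0≡t+t = ≡.cong length
  (filter-accept (isGoodPath? p q t t) {x = []} {xs = []}
    ((ℤ.≤-reflexive (≡.sym p≡q) ∷ []) , ≡.trans p≡q q≡t , q≡t))
  where
  open ≡.≡-Reasoning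
  p≡q : p ≡ q
  p≡q = ≡.trans p≡q+0 (ℤ.+-identityʳ q)
  q≡t : q ≡ t
  q≡t = +-double-injective q t (begin
    q ℤ.+ q          ≡⟨ ≡.cong (ℤ._+ q) p≡q ⟨
    p ℤ.+ q          ≡⟨ ℤ.+-identityʳ (p ℤ.+ q) ⟨
    p ℤ.+ q ℤ.+ + 0  ≡⟨ p+q+0≡t+t ⟩
    t ℤ.+ t          ∎)
goodPaths≡ballot zero (suc d) p q t p≡q+d _ =
  ≡.cong length (filter-reject (isGoodPath? p q t t) {x = []} {xs = []} λ (_ , p≡t , q≡t) →
    ℤ.<⇒≢ (ℤ.+-monoʳ-< q (ℤ.+<+ (s≤s z≤n)))
      (≡.trans (ℤ.+-identityʳ q) (≡.trans q≡t (≡.trans (≡.sym p≡t) p≡q+d))))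
goodPaths≡ballot (suc k) zero p q t p≡q+0 p+q+1+k≡t+t = begin
  goodPaths (suc k) p q t
    ≡⟨ goodPaths-suc k t (start-below q 0 p≡q+0) ⟩
  goodPaths k (p ℤ.+ ℤ.1ℤ) q t ℕ.+ goodPaths k p (q ℤ.+ ℤ.1ℤ) t
    ≡⟨ ≡.cong₂ ℕ._+_
         (goodPaths≡ballot k 1 (p ℤ.+ ℤ.1ℤ) q t (right-start q 0 p≡q+0) (right-sum p q k p+q+1+k≡t+t))
         (goodPaths-blocked k t λ q+1≤p →
           ℤ.<⇒≱ (ℤ.+-monoʳ-< q (ℤ.+<+ (s≤s z≤n))) (≡.subst (q ℤ.+ ℤ.1ℤ ℤ.≤_) p≡q+0 q+1≤p)) ⟩
  ballot k 1 ℕ.+ 0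
    ≡⟨ ℕ.+-identityʳ (ballot k 1) ⟩
  ballot k 1 ∎
  where open ≡.≡-Reasoning
goodPaths≡ballot (suc k) (suc d) p q t p≡q+1+d p+q+1+k≡t+t = ≡.trans
  (goodPaths-suc k t (start-below q (suc d) p≡q+1+d))
  (≡.cong₂ ℕ._+_
    (goodPaths≡ballot k (suc (suc d)) (p ℤ.+ ℤ.1ℤ) q t (right-start q (suc d) p≡q+1+d) (right-sum p q k p+q+1+k≡t+t))
    (goodPaths≡ballot k d p (q ℤ.+ ℤ.1ℤ) t (up-start q d p≡q+1+d) (up-sum p q k p+q+1+k≡t+t)))

𝒞≡ballot : ∀ n m → 𝒞 (n ℕ.+ m) m ≡ ballot (2 ℕ.* m ℕ.+ (n ℕ.+ n)) (2 ℕ.* m)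
𝒞≡ballot n m rewrite ℕ.m+n∸n≡m n m = begin
  goodPaths ∣ (+ n ℤ.+ + n) ℤ.- (+ 0 ℤ.+ ℤ.- + (2 ℕ.* m)) ∣ (+ 0) (ℤ.- + (2 ℕ.* m)) (+ n)
    ≡⟨ ≡.cong (λ k → goodPaths ∣ k ∣ (+ 0) (ℤ.- + (2 ℕ.* m)) (+ n)) length≡ ⟩
  goodPaths (2 ℕ.* m ℕ.+ (n ℕ.+ n)) (+ 0) (ℤ.- + (2 ℕ.* m)) (+ n)
    ≡⟨ goodPaths≡ballot _ (2 ℕ.* m) (+ 0) (ℤ.- + (2 ℕ.* m)) (+ n)
         (≡.sym (ℤ.+-inverseˡ (+ (2 ℕ.* m)))) sum≡ ⟩
  ballot (2 ℕ.* m ℕ.+ (n ℕ.+ n)) (2 ℕ.* m) ∎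
  where
  open ≡.≡-Reasoning
  open IntegerSolver using (solve; _:+_; _:-_; :-_; _:=_; con)
  length≡ : (+ n ℤ.+ + n) ℤ.- (+ 0 ℤ.+ ℤ.- + (2 ℕ.* m)) ≡ + (2 ℕ.* m ℕ.+ (n ℕ.+ n))
  length≡ = solve 2 (λ n d → (n :+ n) :- (con (+ 0) :+ :- d) := d :+ (n :+ n)) ≡.refl (+ n) (+ (2 ℕ.* m))
  sum≡ : + 0 ℤ.+ ℤ.- + (2 ℕ.* m) ℤ.+ + (2 ℕ.* m ℕ.+ (n ℕ.+ n)) ≡ + n ℤ.+ + n
  sum≡ = solve 2 (λ n d → con (+ 0) :+ :- d :+ (d :+ (n :+ n)) := n :+ n) ≡.refl (+ n) (+ (2 ℕ.* m))

-- The ballot series in ℚ[[x]]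

ℕtoℚ-+ : ∀ a b → ℕtoℚ (a ℕ.+ b) ≡ ℕtoℚ a ℚ.+ ℕtoℚ b
ℕtoℚ-+ a b = begin
  + (a ℕ.+ b) ℚ./ 1
    ≡⟨ ℚ./-cong (≡.sym (≡.cong₂ ℤ._+_ (ℤ.*-identityʳ (+ a)) (ℤ.*-identityʳ (+ b)))) ≡.refl ⟩
  (+ a ℤ.* + 1 ℤ.+ + b ℤ.* + 1) ℚ./ (1 ℕ.* 1)
    ≡⟨ ≡.cong₂ ℚ._+_ (as-mkℚ a) (as-mkℚ b) ⟨
  ℕtoℚ a ℚ.+ ℕtoℚ b ∎
  where
  open ≡.≡-Reasoning
  as-mkℚ : ∀ k → ℕtoℚ k ≡ ℚ.mkℚ (+ k) 0 (Coprime.sym (Coprime.1-coprimeTo k))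
  as-mkℚ k = ℚ.normalize-coprime (Coprime.sym (Coprime.1-coprimeTo k))

module Univariate = PowerSeries ℚ.+-*-commutativeRing
open Univariate using () renaming (_≋_ to _≋₁_; _⊛_ to _⊛₁_; constant to constant₁; 𝕏 to 𝕏₁; 0ₚ to 0₁)

-- The coefficient of x^j in ballotSeries d counts the paths from (0, -d) to (j, j) never
-- crossing the diagonal.
ballotSeries : ℕ → Univariate.PowerSeries
ballotSeries d j = ℕtoℚ (ballot (d ℕ.+ (j ℕ.+ j)) d)

catalan : Univariate.PowerSeries
catalan = ballotSeries 0

ballotSeries-zero : ∀ d → ballotSeries d 0 ≡ 1ℚ
ballotSeries-zero d =
  ≡.cong ℕtoℚ (≡.trans (≡.cong (λ k → ballot k d) (ℕ.+-identityʳ d)) (ballot-diagonal d))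

catalan-suc : ∀ j → catalan (suc j) ≡ ballotSeries 1 j
catalan-suc j = ≡.cong (λ k → ℕtoℚ (ballot k 1)) (ℕ.+-suc j j)

ballotSeries-suc-suc : ∀ d j →
  ballotSeries (suc d) (suc j) ≡ ballotSeries (suc (suc d)) j ℚ.+ ballotSeries d (suc j)
ballotSeries-suc-suc d j = ≡.trans
  (≡.cong (λ k → ℕtoℚ (ballot k (suc (suc d)) ℕ.+ ballot (d ℕ.+ (suc j ℕ.+ suc j)) d)) length≡)
  (ℕtoℚ-+ (ballot (suc (suc d) ℕ.+ (j ℕ.+ j)) (suc (suc d))) (ballot (d ℕ.+ (suc j ℕ.+ suc j)) d))
  where
  length≡ : d ℕ.+ (suc j ℕ.+ suc j) ≡ suc (suc d) ℕ.+ (j ℕ.+ j)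
  length≡ = ≡.trans (≡.cong (d ℕ.+_) (ℕ.+-suc (suc j) j))
    (≡.trans (ℕ.+-suc d (suc (j ℕ.+ j))) (≡.cong suc (ℕ.+-suc d (j ℕ.+ j))))

-- The combinatorial first-passage decomposition, proved from the ballot recurrence by strong
-- induction on the coefficient index, simultaneously for all d.
ballotSeries-suc : ∀ d → ballotSeries (suc d) ≋₁ catalan ⊛₁ ballotSeries d
ballotSeries-suc d j = first-passage j j ℕ.≤-refl d
  where
  open ≡.≡-Reasoning
  open Univariate using (⊛-congˡ-≤; ⊛-congʳ-≤; ⊛-suc; ⊛-assoc)
  first-passage : ∀ j i → i ℕ.≤ j → ∀ d → ballotSeries (suc d) i ≡ (catalan ⊛₁ ballotSeries d) i
  first-passage zero .zero z≤n d =
    ≡.trans (ballotSeries-zero (suc d)) (≡.sym (≡.cong (1ℚ ℚ.*_) (ballotSeries-zero d)))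
  first-passage (suc j) i i≤1+j d with ℕ.m≤n⇒m<n∨m≡n i≤1+j
  ... | inj₁ (s≤s i≤j) = first-passage j i i≤j d
  ... | inj₂ ≡.refl = begin
    ballotSeries (suc d) (suc j)
      ≡⟨ ballotSeries-suc-suc d j ⟩
    ballotSeries (suc (suc d)) j ℚ.+ ballotSeries d (suc j)
      ≡⟨ ≡.cong₂ ℚ._+_ two-steps (≡.sym (ℚ.*-identityˡ (ballotSeries d (suc j)))) ⟩
    ((catalan ∘ suc) ⊛₁ ballotSeries d) j ℚ.+ catalan 0 ℚ.* ballotSeries d (suc j)
      ≡⟨ ℚ.+-comm _ (catalan 0 ℚ.* ballotSeries d (suc j)) ⟩
    catalan 0 ℚ.* ballotSeries d (suc j) ℚ.+ ((catalan ∘ suc) ⊛₁ ballotSeries d) j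
      ≡⟨ ⊛-suc j catalan (ballotSeries d) ⟨
    (catalan ⊛₁ ballotSeries d) (suc j) ∎
    where
    two-steps : ballotSeries (suc (suc d)) j ≡ ((catalan ∘ suc) ⊛₁ ballotSeries d) j
    two-steps = begin
      ballotSeries (suc (suc d)) j
        ≡⟨ first-passage j j ℕ.≤-refl (suc d) ⟩
      (catalan ⊛₁ ballotSeries (suc d)) j
        ≡⟨ ⊛-congʳ-≤ j catalan (λ i i≤j → first-passage j i i≤j d) ⟩
      (catalan ⊛₁ (catalan ⊛₁ ballotSeries d)) j
        ≡⟨ ⊛-assoc catalan catalan (ballotSeries d) j ⟨
      ((catalan ⊛₁ catalan) ⊛₁ ballotSeries d) j
        ≡⟨ ⊛-congˡ-≤ j (ballotSeries d) (λ i i≤j → ≡.sym (≡.trans (catalan-suc i) (first-passage j i i≤j 0))) ⟩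
      ((catalan ∘ suc) ⊛₁ ballotSeries d) j ∎

-- The bivariate series ring

-- ℚ[[x,y]] is realised as ℚ[[y]][[x]]; its coefficient functions are exactly those of Series₂.
module Bivariate = PowerSeries Univariate.commutativeRing
open Bivariate using () renaming (_⊛_ to _⊛₂_; constant to constant₂; 𝕏 to 𝕏₂; 0ₚ to 0₂; ⊝_ to ⊝₂_)

sumTo≡∑≤ : ∀ n f → sumTo n f ≡ Univariate.∑≤ n f
sumTo≡∑≤ zero    f = ≡.refl
sumTo≡∑≤ (suc n) f = ≡.cong (ℚ._+ f (suc n)) (sumTo≡∑≤ n f)

*ₛ≈⊛ : ∀ f g → f *ₛ g ≈ f ⊛₂ g
*ₛ≈⊛ f g n m = begin
  sumTo n (λ i → sumTo m (λ j → f i j ℚ.* g (n ∸ i) (m ∸ j)))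
    ≡⟨ sumTo≡∑≤ n _ ⟩
  Univariate.∑≤ n (λ i → sumTo m (λ j → f i j ℚ.* g (n ∸ i) (m ∸ j)))
    ≡⟨ Univariate.∑≤-cong n (λ i _ → sumTo≡∑≤ m _) ⟩
  Univariate.∑≤ n (λ i → (f i ⊛₁ g (n ∸ i)) m)
    ≡⟨ Univariate.∑≤ₚ-apply n _ m ⟨
  (f ⊛₂ g) n m ∎
  where open ≡.≡-Reasoning

-- Its multiplication is _*ₛ_ itself rather than the pointwise-equal ⊛₂, so ring identities
-- apply verbatim to terms built with _*ₛ_.
*ₛ-commutativeRing : CommutativeRing _ _
*ₛ-commutativeRing = withMultiplication Bivariate.commutativeRing _*ₛ_ *ₛ≈⊛

module 𝕊 = CommutativeRing *ₛ-commutativeRing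

cst≈constant : ∀ a → cst a ≈ constant₂ (constant₁ a)
cst≈constant a zero    zero    = ≡.refl
cst≈constant a zero    (suc m) = ≡.refl
cst≈constant a (suc n) m       = ≡.refl

X≈𝕏 : X ≈ 𝕏₂
X≈𝕏 zero          m       = ≡.refl
X≈𝕏 (suc zero)    zero    = ≡.refl
X≈𝕏 (suc zero)    (suc m) = ≡.refl
X≈𝕏 (suc (suc n)) m       = ≡.refl

Y≈constant𝕏 : Y ≈ constant₂ 𝕏₁
Y≈constant𝕏 zero    zero          = ≡.refl
Y≈constant𝕏 zero    (suc zero)    = ≡.refl
Y≈constant𝕏 zero    (suc (suc m)) = ≡.refl
Y≈constant𝕏 (suc n) m             = ≡.refl

ι≈constant : ∀ a → ι a ≈ (λ n → constant₁ (a n))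
ι≈constant a n zero    = ≡.refl
ι≈constant a n (suc m) = ≡.refl

*ₛ≈⊛-congˡ : ∀ {f F} g → f ≈ F → f *ₛ g ≈ F ⊛₂ g
*ₛ≈⊛-congˡ {f} g f≈F n m = ≡.trans (*ₛ≈⊛ f g n m) (Bivariate.⊛-congˡ-≤ n g (λ i _ → f≈F i) m)

cst-*ₛ : ∀ a f n m → (cst a *ₛ f) n m ≡ a ℚ.* f n m
cst-*ₛ a f n m = begin
  (cst a *ₛ f) n m                     ≡⟨ *ₛ≈⊛-congˡ f (cst≈constant a) n m ⟩
  (constant₂ (constant₁ a) ⊛₂ f) n m   ≡⟨ Bivariate.constant-⊛ (constant₁ a) f n m ⟩
  (constant₁ a ⊛₁ f n) m               ≡⟨ Univariate.constant-⊛ a (f n) m ⟩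
  a ℚ.* f n m                          ∎
  where open ≡.≡-Reasoning

X-*ₛ-zero : ∀ f m → (X *ₛ f) 0 m ≡ 0ℚ
X-*ₛ-zero f m = ≡.trans (*ₛ≈⊛-congˡ f X≈𝕏 0 m) (Bivariate.𝕏-⊛-zero f m)

X-*ₛ-suc : ∀ f n m → (X *ₛ f) (suc n) m ≡ f n m
X-*ₛ-suc f n m = ≡.trans (*ₛ≈⊛-congˡ f X≈𝕏 (suc n) m) (Bivariate.𝕏-⊛-suc f n m)

Y-*ₛ-zero : ∀ f n → (Y *ₛ f) n 0 ≡ 0ℚ
Y-*ₛ-zero f n = begin
  (Y *ₛ f) n 0             ≡⟨ *ₛ≈⊛-congˡ f Y≈constant𝕏 n 0 ⟩
  (constant₂ 𝕏₁ ⊛₂ f) n 0  ≡⟨ Bivariate.constant-⊛ 𝕏₁ f n 0 ⟩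
  (𝕏₁ ⊛₁ f n) 0            ≡⟨ Univariate.𝕏-⊛-zero (f n) ⟩
  0ℚ                       ∎
  where open ≡.≡-Reasoning

Y-*ₛ-suc : ∀ f n m → (Y *ₛ f) n (suc m) ≡ f n m
Y-*ₛ-suc f n m = begin
  (Y *ₛ f) n (suc m)             ≡⟨ *ₛ≈⊛-congˡ f Y≈constant𝕏 n (suc m) ⟩
  (constant₂ 𝕏₁ ⊛₂ f) n (suc m)  ≡⟨ Bivariate.constant-⊛ 𝕏₁ f n (suc m) ⟩
  (𝕏₁ ⊛₁ f n) (suc m)            ≡⟨ Univariate.𝕏-⊛-suc (f n) m ⟩
  f n m                          ∎
  where open ≡.≡-Reasoning

ι-*ₛ : ∀ a f n m → (ι a *ₛ f) n m ≡ (a ⊛₁ (λ k → f k m)) n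
ι-*ₛ a f n m = begin
  (ι a *ₛ f) n m
    ≡⟨ *ₛ≈⊛-congˡ f (ι≈constant a) n m ⟩
  ((λ k → constant₁ (a k)) ⊛₂ f) n m
    ≡⟨ Univariate.∑≤ₚ-apply n _ m ⟩
  Univariate.∑≤ n (λ i → (constant₁ (a i) ⊛₁ f (n ∸ i)) m)
    ≡⟨ Univariate.∑≤-cong n (λ i _ → Univariate.constant-⊛ (a i) (f (n ∸ i)) m) ⟩
  (a ⊛₁ (λ k → f k m)) n ∎
  where open ≡.≡-Reasoning

cst-homomorphism :
  CommutativeRing.rawRing ℚ.+-*-commutativeRing -Raw-AlmostCommutative⟶ fromCommutativeRing *ₛ-commutativeRing
cst-homomorphism = record
  { ⟦_⟧    = cst
  ; +-homo = cst-+
  ; *-homo = cst-*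
  ; -‿homo = cst-neg
  ; 0-homo = cst-0
  ; 1-homo = cst≈constant 1ℚ
  }
  where
  cst-0 : cst 0ℚ ≈ 0₂
  cst-0 zero    zero    = ≡.refl
  cst-0 zero    (suc m) = ≡.refl
  cst-0 (suc n) m       = ≡.refl

  cst-+ : ∀ a b → cst (a ℚ.+ b) ≈ cst a +ₛ cst b
  cst-+ a b zero    zero    = ≡.refl
  cst-+ a b zero    (suc m) = ≡.refl
  cst-+ a b (suc n) m       = ≡.refl

  cst-neg : ∀ a → cst (ℚ.- a) ≈ ⊝₂ cst a
  cst-neg a zero    zero    = ≡.refl
  cst-neg a zero    (suc m) = ≡.refl
  cst-neg a (suc n) m       = ≡.refl

  cst-* : ∀ a b → cst (a ℚ.* b) ≈ cst a *ₛ cst b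
  cst-* a b n m = ≡.trans (scaled n m) (≡.sym (cst-*ₛ a (cst b) n m))
    where
    scaled : ∀ n m → cst (a ℚ.* b) n m ≡ a ℚ.* cst b n m
    scaled zero    zero    = ≡.refl
    scaled zero    (suc m) = ≡.sym (ℚ.*-zeroʳ a)
    scaled (suc n) m       = ≡.sym (ℚ.*-zeroʳ a)

-- The coefficients are rationals embedded by cst, so numerals like 2 · 2 = 4 normalise.
module *ₛ-Solver = RingSolver (CommutativeRing.rawRing ℚ.+-*-commutativeRing)
  (fromCommutativeRing *ₛ-commutativeRing) cst-homomorphism
  (λ a b → Maybe.map (λ a≡b n m → ≡.cong (λ c → cst c n m) a≡b) (dec⇒maybe (a ℚ.≟ b)))

-- The generating functions γ₀ and Γ

γ₀-coefficient : ∀ n → γ₀ n 0 ≡ catalan n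
γ₀-coefficient n =
  ≡.cong ℕtoℚ (≡.trans (≡.cong (λ k → 𝒞 k 0) (≡.sym (ℕ.+-identityʳ n))) (𝒞≡ballot n 0))

γ₀-*ₛ : ∀ f n m → (γ₀ *ₛ f) n m ≡ (catalan ⊛₁ (λ k → f k m)) n
γ₀-*ₛ f n m =
  ≡.trans (ι-*ₛ _ f n m) (Univariate.⊛-congˡ-≤ n (λ k → f k m) (λ i _ → γ₀-coefficient i))

γ₀-*ₛ-Γ : ∀ n m → (γ₀ *ₛ Γ) n m ≡ ballotSeries (suc (2 ℕ.* m)) n
γ₀-*ₛ-Γ n m = begin
  (γ₀ *ₛ Γ) n m                             ≡⟨ γ₀-*ₛ Γ n m ⟩
  (catalan ⊛₁ (λ k → Γ k m)) n              ≡⟨ Univariate.⊛-congʳ-≤ n catalan (λ k _ → ≡.cong ℕtoℚ (𝒞≡ballot k m)) ⟩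
  (catalan ⊛₁ ballotSeries (2 ℕ.* m)) n     ≡⟨ ballotSeries-suc (2 ℕ.* m) n ⟨
  ballotSeries (suc (2 ℕ.* m)) n            ∎
  where open ≡.≡-Reasoning

γ₀-catalan : γ₀ ≈ cst 1ℚ +ₛ X *ₛ (γ₀ *ₛ γ₀)
γ₀-catalan zero    zero    = ≡.sym (≡.cong (1ℚ ℚ.+_) (X-*ₛ-zero (γ₀ *ₛ γ₀) 0))
γ₀-catalan zero    (suc m) = ≡.sym (≡.cong (0ℚ ℚ.+_) (X-*ₛ-zero (γ₀ *ₛ γ₀) (suc m)))
γ₀-catalan (suc n) zero    = begin
  γ₀ (suc n) 0                           ≡⟨ γ₀-coefficient (suc n) ⟩
  catalan (suc n)                        ≡⟨ ≡.trans (catalan-suc n) (ballotSeries-suc 0 n) ⟩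
  (catalan ⊛₁ catalan) n                 ≡⟨ Univariate.⊛-congʳ-≤ n catalan (λ k _ → ≡.sym (γ₀-coefficient k)) ⟩
  (catalan ⊛₁ (λ k → γ₀ k 0)) n          ≡⟨ γ₀-*ₛ γ₀ n 0 ⟨
  (γ₀ *ₛ γ₀) n 0                         ≡⟨ ℚ.+-identityˡ _ ⟨
  0ℚ ℚ.+ (γ₀ *ₛ γ₀) n 0                  ≡⟨ ≡.cong (0ℚ ℚ.+_) (X-*ₛ-suc (γ₀ *ₛ γ₀) n 0) ⟨
  (cst 1ℚ +ₛ X *ₛ (γ₀ *ₛ γ₀)) (suc n) 0  ∎
  where open ≡.≡-Reasoning
γ₀-catalan (suc n) (suc m) = begin
  0ℚ                                           ≡⟨ CommutativeRing.zeroʳ Univariate.commutativeRing catalan n ⟨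
  (catalan ⊛₁ 0₁) n                            ≡⟨ γ₀-*ₛ γ₀ n (suc m) ⟨
  (γ₀ *ₛ γ₀) n (suc m)                         ≡⟨ ℚ.+-identityˡ _ ⟨
  0ℚ ℚ.+ (γ₀ *ₛ γ₀) n (suc m)                  ≡⟨ ≡.cong (0ℚ ℚ.+_) (X-*ₛ-suc (γ₀ *ₛ γ₀) n (suc m)) ⟨
  (cst 1ℚ +ₛ X *ₛ (γ₀ *ₛ γ₀)) (suc n) (suc m)  ∎
  where open ≡.≡-Reasoning

Γ-recursion : Γ ≈ γ₀ +ₛ Y *ₛ (γ₀ *ₛ (γ₀ *ₛ Γ))
Γ-recursion n zero    = begin
  Γ n 0                               ≡⟨ ≡.cong (λ k → ℕtoℚ (𝒞 k 0)) (ℕ.+-identityʳ n) ⟩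
  γ₀ n 0                              ≡⟨ ℚ.+-identityʳ _ ⟨
  γ₀ n 0 ℚ.+ 0ℚ                       ≡⟨ ≡.cong (γ₀ n 0 ℚ.+_) (Y-*ₛ-zero (γ₀ *ₛ (γ₀ *ₛ Γ)) n) ⟨
  (γ₀ +ₛ Y *ₛ (γ₀ *ₛ (γ₀ *ₛ Γ))) n 0  ∎
  where open ≡.≡-Reasoning
Γ-recursion n (suc m) = begin
  Γ n (suc m)                                   ≡⟨ ≡.cong ℕtoℚ (𝒞≡ballot n (suc m)) ⟩
  ballotSeries (2 ℕ.* suc m) n                  ≡⟨ ≡.cong (λ d → ballotSeries d n) (ℕ.*-suc 2 m) ⟩
  ballotSeries (suc (suc (2 ℕ.* m))) n          ≡⟨ ballotSeries-suc (suc (2 ℕ.* m)) n ⟩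
  (catalan ⊛₁ ballotSeries (suc (2 ℕ.* m))) n   ≡⟨ Univariate.⊛-congʳ-≤ n catalan (λ k _ → ≡.sym (γ₀-*ₛ-Γ k m)) ⟩
  (catalan ⊛₁ (λ k → (γ₀ *ₛ Γ) k m)) n          ≡⟨ γ₀-*ₛ (γ₀ *ₛ Γ) n m ⟨
  (γ₀ *ₛ (γ₀ *ₛ Γ)) n m                         ≡⟨ ℚ.+-identityˡ _ ⟨
  0ℚ ℚ.+ (γ₀ *ₛ (γ₀ *ₛ Γ)) n m                  ≡⟨ ≡.cong (0ℚ ℚ.+_) (Y-*ₛ-suc (γ₀ *ₛ (γ₀ *ₛ Γ)) n m) ⟨
  (γ₀ +ₛ Y *ₛ (γ₀ *ₛ (γ₀ *ₛ Γ))) n (suc m)      ∎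
  where open ≡.≡-Reasoning

two-regular : Regular ℚ.+-*-commutativeRing (ℕtoℚ 2)
two-regular a a*2≡0 = begin
  a                     ≡⟨ solve 1 (λ a → a := a :* con (ℕtoℚ 2) :* con ℚ.½) ≡.refl a ⟩
  a ℚ.* ℕtoℚ 2 ℚ.* ℚ.½  ≡⟨ ≡.cong (ℚ._* ℚ.½) a*2≡0 ⟩
  0ℚ ℚ.* ℚ.½            ≡⟨⟩
  0ℚ                    ∎
  where
  open ≡.≡-Reasoning
  open RationalSolver using (solve; _:*_; _:=_; con)

regular-*ₛ : ∀ f → Regular ℚ.+-*-commutativeRing (f 0 0) → Regular *ₛ-commutativeRing f
regular-*ₛ f f₀₀-regular g g*f≈0 =
  Bivariate.regular-constantTerm⇒regular {f} (Univariate.regular-constantTerm⇒regular {f 0} f₀₀-regular) g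
    (λ n m → ≡.trans (≡.sym (*ₛ≈⊛ g f n m)) (g*f≈0 n m))

-- Ring algebra in ℚ[[x,y]]

√[1-4x] : Series₂
√[1-4x] = cst 1ℚ -ₛ cst (ℕtoℚ 2) *ₛ X *ₛ γ₀

module _ where
  open *ₛ-Solver using (solve; _:+_; _:-_; _:*_; _:=_; con)
  open 𝕊 using (_+_; _*_; _-_; +-congˡ; +-congʳ; *-congˡ; -‿cong)
  open SetoidReasoning 𝕊.setoid

  √[1-4x]-squared : √[1-4x] *ₛ √[1-4x] ≈ cst 1ℚ -ₛ cst (ℕtoℚ 4) *ₛ X
  √[1-4x]-squared = begin
    √[1-4x] * √[1-4x]
      ≈⟨ solve 2 (λ x g → (con 1ℚ :- con (ℕtoℚ 2) :* x :* g) :* (con 1ℚ :- con (ℕtoℚ 2) :* x :* g)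
                        := con 1ℚ :- con (ℕtoℚ 4) :* x :* (g :- x :* (g :* g))) 𝕊.refl X γ₀ ⟩
    cst 1ℚ - cst (ℕtoℚ 4) * X * (γ₀ - X * (γ₀ * γ₀))
      ≈⟨ +-congˡ {cst 1ℚ} (-‿cong (*-congˡ {cst (ℕtoℚ 4) * X} (+-congʳ {𝕊.- (X * (γ₀ * γ₀))} γ₀-catalan))) ⟩
    cst 1ℚ - cst (ℕtoℚ 4) * X * (cst 1ℚ + X * (γ₀ * γ₀) - X * (γ₀ * γ₀))
      ≈⟨ solve 2 (λ x g → con 1ℚ :- con (ℕtoℚ 4) :* x :* (con 1ℚ :+ x :* (g :* g) :- x :* (g :* g))
                        := con 1ℚ :- con (ℕtoℚ 4) :* x) 𝕊.refl X γ₀ ⟩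
    cst 1ℚ - cst (ℕtoℚ 4) * X ∎

  Γ-closed-form : Γ *ₛ (cst 1ℚ -ₛ Y *ₛ γ₀ *ₛ γ₀) ≈ γ₀
  Γ-closed-form = begin
    Γ * (cst 1ℚ - Y * γ₀ * γ₀)
      ≈⟨ solve 3 (λ G y g → G :* (con 1ℚ :- y :* g :* g) := G :- y :* (g :* (g :* G))) 𝕊.refl Γ Y γ₀ ⟩
    Γ - Y * (γ₀ * (γ₀ * Γ))
      ≈⟨ +-congʳ {𝕊.- (Y * (γ₀ * (γ₀ * Γ)))} Γ-recursion ⟩
    γ₀ + Y * (γ₀ * (γ₀ * Γ)) - Y * (γ₀ * (γ₀ * Γ))
      ≈⟨ solve 3 (λ G y g → g :+ y :* (g :* (g :* G)) :- y :* (g :* (g :* G)) := g) 𝕊.refl Γ Y γ₀ ⟩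
    γ₀ ∎

  module _ (s : ℕ → ℚ) where

    -- The coefficient of x² is 2 - 0.
    denominator≉0 : ¬ (cst (ℕtoℚ 2) *ₛ X *ₛ (X +ₛ Y) -ₛ Y *ₛ (cst 1ℚ -ₛ ι s) ≈ cst 0ℚ)
    denominator≉0 D≈0 with ≡.trans (≡.sym (≡.cong (λ q → ℕtoℚ 2 ℚ.- q) (Y-*ₛ-zero (cst 1ℚ -ₛ ι s) 2))) (D≈0 2 0)
    ... | ()

    module _ (s₀≡1 : s 0 ≡ 1ℚ) (s²≡1-4x : ι s *ₛ ι s ≈ cst 1ℚ -ₛ cst (ℕtoℚ 4) *ₛ X) where

      -- Both square to 1 - 4x, and the constant term of their sum is 2.
      s≈√[1-4x] : ι s ≈ √[1-4x]
      s≈√[1-4x] = square-injective *ₛ-commutativeRing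
        (regular-*ₛ (ι s +ₛ √[1-4x])
          (≡.subst (Regular ℚ.+-*-commutativeRing) (≡.cong (ℚ._+ 1ℚ) (≡.sym s₀≡1)) two-regular))
        (𝕊.trans s²≡1-4x (𝕊.sym √[1-4x]-squared))

      γ₀-closed-form : cst (ℕtoℚ 2) *ₛ X *ₛ γ₀ ≈ cst 1ℚ -ₛ ι s
      γ₀-closed-form = begin
        cst (ℕtoℚ 2) * X * γ₀
          ≈⟨ solve 2 (λ x g → con (ℕtoℚ 2) :* x :* g := con 1ℚ :- (con 1ℚ :- con (ℕtoℚ 2) :* x :* g)) 𝕊.refl X γ₀ ⟩
        cst 1ℚ - √[1-4x]
          ≈⟨ +-congˡ {cst 1ℚ} (-‿cong (𝕊.sym s≈√[1-4x])) ⟩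
        cst 1ℚ - ι s ∎

      Γ-rational-form :
        Γ *ₛ (cst (ℕtoℚ 2) *ₛ X *ₛ (X +ₛ Y) -ₛ Y *ₛ (cst 1ℚ -ₛ ι s)) ≈ X *ₛ (cst 1ℚ -ₛ ι s)
      Γ-rational-form = begin
        Γ * (cst (ℕtoℚ 2) * X * (X + Y) - Y * (cst 1ℚ - ι s))
          ≈⟨ *-congˡ {Γ} (+-congˡ {cst (ℕtoℚ 2) * X * (X + Y)} (-‿cong (*-congˡ {Y} 1-s≈2x[1+xγ₀²]))) ⟩
        Γ * (cst (ℕtoℚ 2) * X * (X + Y) - Y * (cst (ℕtoℚ 2) * X * (cst 1ℚ + X * (γ₀ * γ₀))))
          ≈⟨ solve 4 (λ G x y g →
                 G :* (con (ℕtoℚ 2) :* x :* (x :+ y) :- y :* (con (ℕtoℚ 2) :* x :* (con 1ℚ :+ x :* (g :* g))))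
              := con (ℕtoℚ 2) :* x :* x :* (G :* (con 1ℚ :- y :* g :* g))) 𝕊.refl Γ X Y γ₀ ⟩
        cst (ℕtoℚ 2) * X * X * (Γ * (cst 1ℚ - Y * γ₀ * γ₀))
          ≈⟨ *-congˡ {cst (ℕtoℚ 2) * X * X} Γ-closed-form ⟩
        cst (ℕtoℚ 2) * X * X * γ₀
          ≈⟨ solve 2 (λ x g → con (ℕtoℚ 2) :* x :* x :* g := x :* (con (ℕtoℚ 2) :* x :* g)) 𝕊.refl X γ₀ ⟩
        X * (cst (ℕtoℚ 2) * X * γ₀)
          ≈⟨ *-congˡ {X} γ₀-closed-form ⟩
        X * (cst 1ℚ - ι s) ∎
        where
        1-s≈2x[1+xγ₀²] : cst 1ℚ -ₛ ι s ≈ cst (ℕtoℚ 2) *ₛ X *ₛ (cst 1ℚ +ₛ X *ₛ (γ₀ *ₛ γ₀))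
        1-s≈2x[1+xγ₀²] = 𝕊.trans (𝕊.sym γ₀-closed-form) (*-congˡ {cst (ℕtoℚ 2) * X} γ₀-catalan)

theorem6p1 : (s : ℕ → ℚ) → s 0 ≡ 1ℚ →
    ι s *ₛ ι s ≈ cst 1ℚ -ₛ cst (ℕtoℚ 4) *ₛ X →
    (cst (ℕtoℚ 2) *ₛ X *ₛ γ₀ ≈ cst 1ℚ -ₛ ι s)
    × (Γ *ₛ (cst 1ℚ -ₛ Y *ₛ γ₀ *ₛ γ₀) ≈ γ₀)
    × (¬ (cst (ℕtoℚ 2) *ₛ X *ₛ (X +ₛ Y) -ₛ Y *ₛ (cst 1ℚ -ₛ ι s) ≈ cst 0ℚ))
    × (Γ *ₛ (cst (ℕtoℚ 2) *ₛ X *ₛ (X +ₛ Y) -ₛ Y *ₛ (cst 1ℚ -ₛ ι s))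
        ≈ X *ₛ (cst 1ℚ -ₛ ι s))
theorem6p1 s s₀≡1 s²≡1-4x =
  γ₀-closed-form s s₀≡1 s²≡1-4x , Γ-closed-form , denominator≉0 s , Γ-rational-form s s₀≡1 s²≡1-4x
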